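{- For every graph $G$ with minimum degree $\delta(G)\ge 2$, $\gamma_{t\times 2}(G)\le 3\gamma_2(G)-2$.
   Context: $G=(V,E)$ finite simple graph; $N(v)$ open neighborhood. $\gamma_2(G)$ is the minimum size of a set $D\subseteq V$ such that every vertex not in $D$ has at least two neighbors in $D$. $\gamma_{t\times 2}(G)$ is the minimum size of a set $D\subseteq V$ such that $|N(v)\cap D|\ge 2$ for every $v\in V$. -}

module Defs where

open import Data.Nat using (ℕ; _≤_; _+_; _*_)
open import Data.Bool using (Bool; true; false; if_then_else_)
open import Data.Fin using (Fin)
open import Data.Fin.Subset using (Subset; _∈_; _∉_; ∣_∣)
open import Data.Fin.Subset.Properties using (_∈?_)
open import Data.Product using (Σ; _×_)
open import Data.Nat using (zero; suc)
open import Data.List using (List; allFin; filter; length)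
open import Relation.Binary.PropositionalEquality using (_≡_)
open import Relation.Nullary using (¬_)
open import Data.Bool.Properties using (T?)
open import Data.Bool using (T)

record Graph (n : ℕ) : Set where
  field
    adj       : Fin n → Fin n → Bool
    irrefl    : ∀ v → adj v v ≡ false
    sym       : ∀ u v → adj u v ≡ adj v u

open Graph public

degree : ∀ {n} → Graph n → Fin n → ℕ
degree {n} G v = length (filter (λ u → T? (adj G v u)) (allFin n))

MinDegreeAtLeast : ∀ {n} → Graph n → ℕ → Set
MinDegreeAtLeast G k = ∀ v → k ≤ degree G v

nbrsIn : ∀ {n} → Graph n → Subset n → Fin n → ℕ
nbrsIn {n} G D v =
  length (filter (λ u → T? (adj G v u)) (filter (λ u → u ∈? D) (allFin n)))

IsTwoDominating : ∀ {n} → Graph n → Subset n → Set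
IsTwoDominating G D = ∀ v → v ∉ D → 2 ≤ nbrsIn G D v

IsDoubleTotalDominating : ∀ {n} → Graph n → Subset n → Set
IsDoubleTotalDominating G D = ∀ v → 2 ≤ nbrsIn G D v

IsMinSize : ∀ {n} → (Subset n → Set) → ℕ → Set
IsMinSize {n} P k =
  Σ (Subset n) (λ D → P D × ∣ D ∣ ≡ k) × (∀ D → P D → k ≤ ∣ D ∣)

IsGamma2 : ∀ {n} → Graph n → ℕ → Set
IsGamma2 G = IsMinSize (IsTwoDominating G)

IsGammaTimes2 : ∀ {n} → Graph n → ℕ → Set
IsGammaTimes2 G = IsMinSize (IsDoubleTotalDominating G)

module Submission where

-- Let D be a minimum 2-dominating set.  Vertices outside D already have two
-- neighbours in D, so it suffices to give every vertex of D two neighbours;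
-- adding two arbitrary neighbours of each vertex of D gives a double total
-- dominating set of size at most 3|D| (completion lemma).  To save two
-- vertices we first add a short list `extra` to D so that the vertices of a
-- list `removed` ⊆ D already see two neighbours in D ∪ extra; only the other
-- vertices of D receive arbitrary neighbours.  If |extra| + 2 ≤ 2|removed|
-- this yields the bound 3|D| − 2 (saving lemma).  Such lists always exist:
-- either two vertices v, u of D are adjacent (removed = v, u; extra = one
-- further neighbour of each), or some v ∈ D has two neighbours a, b ∉ D,
-- dominated by w, x ∈ D different from v (removed = v, w, x and extra = a, b
-- plus one further neighbour of w and of x; or removed = v, w and extra = a, b
-- when w = x).

open import Defs
open import Data.Nat using (zero; suc; _≤_; _+_; _*_; z≤n; s≤s)
open import Data.Nat.Properties
  using (≤-refl; ≤-reflexive; ≤-trans; m≤n⇒m≤1+n; +-mono-≤; +-monoˡ-≤; +-monoʳ-≤; *-monoʳ-≤; +-suc; +-identityʳ; *-suc; module ≤-Reasoning)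
open import Data.Nat.Tactic.RingSolver using (solve-∀)
open import Data.Bool using (T)
open import Data.Bool.Properties using (T?)
open import Data.Fin using (Fin; zero; suc)
open import Data.Fin.Properties using (_≟_)
open import Data.Fin.Subset using (Subset; _∈_; _∉_; ∣_∣; _∪_; ⁅_⁆; _⊆_; ⊥; ⊤; _-_; inside; outside)
open import Data.Fin.Subset.Properties
  using (_∈?_; ∈⊤; x∈⁅x⁆; ∣⁅x⁆∣≡1; ∣⊥∣≡0; x∈p∪q⁺; p⊆p∪q; q⊆p∪q; x∈p∧x≢y⇒x∈p-y; x∈p⇒∣p-x∣<∣p∣)
open import Data.List using (List; []; _∷_; allFin; filter; length)
open import Data.List.Membership.Propositional using () renaming (_∈_ to _∈ₗ_)
open import Data.List.Membership.Propositional.Properties using (∈-filter⁺; ∈-filter⁻; ∈-allFin)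
open import Data.List.Relation.Unary.Any using (here; there)
open import Data.List.Relation.Unary.All using (All; []; _∷_)
import Data.List.Relation.Unary.All as All
open import Data.List.Relation.Unary.AllPairs using ([]; _∷_)
open import Data.List.Relation.Unary.Unique.Propositional using (Unique)
import Data.List.Relation.Unary.Unique.Propositional.Properties as Unique
open import Data.Vec using ([]; _∷_)
import Data.Vec as Vec
open import Data.Product using (∃; ∃₂; _×_; _,_; proj₂)
open import Data.Sum using (inj₁; inj₂)
open import Data.Empty using (⊥-elim)
open import Function using (_∘_)
open import Relation.Nullary using (yes; no)
open import Relation.Unary using (Decidable)
open import Relation.Binary.PropositionalEquality using (_≡_; _≢_; refl; subst; ≢-sym)
import Relation.Binary.PropositionalEquality as ≡

Adjacent : ∀ {n} → Graph n → Fin n → Fin n → Set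
Adjacent G u v = T (adj G u v)

adjacent? : ∀ {n} (G : Graph n) (y : Fin n) → Decidable (Adjacent G y)
adjacent? G y u = T? (adj G y u)

adjacent-sym : ∀ {n} (G : Graph n) {u v} → Adjacent G u v → Adjacent G v u
adjacent-sym G {u} {v} = subst T (sym G u v)

adjacent⇒≢ : ∀ {n} (G : Graph n) {u v} → Adjacent G u v → u ≢ v
adjacent⇒≢ G {u} u~v refl = subst T (irrefl G u) u~v

-- Two distinct neighbours of y inside the set S: the explicit form of
-- |N(y) ∩ S| ≥ 2 used throughout.
record NeighbourPair {n} (G : Graph n) (S : Subset n) (y : Fin n) : Set where
  constructor neighbourPair
  field
    first second : Fin n
    distinct     : first ≢ second
    first∈S      : first ∈ S
    second∈S     : second ∈ S
    y~first      : Adjacent G y first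
    y~second     : Adjacent G y second

open NeighbourPair

relocate : ∀ {n} {G : Graph n} {S S' y} (p : NeighbourPair G S y) →
  first p ∈ S' → second p ∈ S' → NeighbourPair G S' y
relocate (neighbourPair a b a≢b _ _ y~a y~b) a∈S' b∈S' = neighbourPair a b a≢b a∈S' b∈S' y~a y~b

widen : ∀ {n} {G : Graph n} {S S' y} → S ⊆ S' → NeighbourPair G S y → NeighbourPair G S' y
widen S⊆S' p = relocate p (S⊆S' (first∈S p)) (S⊆S' (second∈S p))

avoiding : ∀ {n} {G : Graph n} {S y} → NeighbourPair G S y →
  ∀ c → ∃ λ o → o ∈ S × Adjacent G y o × o ≢ c
avoiding (neighbourPair a b a≢b a∈S b∈S y~a y~b) c with a ≟ c
... | no a≢c  = a , a∈S , y~a , a≢c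
... | yes refl = b , b∈S , y~b , ≢-sym a≢b

distinct⇒length≥2 : ∀ {A : Set} {a b : A} {ys : List A} →
  a ≢ b → a ∈ₗ ys → b ∈ₗ ys → 2 ≤ length ys
distinct⇒length≥2 {ys = _ ∷ _ ∷ _} _ _ _ = s≤s (s≤s z≤n)
distinct⇒length≥2 {ys = _ ∷ []} a≢b (here refl) (here refl) = ⊥-elim (a≢b refl)
distinct⇒length≥2 {ys = _ ∷ []} _ (there ()) _
distinct⇒length≥2 {ys = _ ∷ []} _ _ (there ())

length≥2⇒distinct : ∀ {A : Set} {ys : List A} → Unique ys → 2 ≤ length ys →
  ∃₂ λ a b → a ≢ b × a ∈ₗ ys × b ∈ₗ ys
length≥2⇒distinct {ys = a ∷ b ∷ _} ((a≢b ∷ _) ∷ _) _ = a , b , a≢b , here refl , there (here refl)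
length≥2⇒distinct {ys = _ ∷ []} _ (s≤s ())

pairFromList : ∀ {n} {G : Graph n} {S y} {xs : List (Fin n)} → Unique xs →
  (∀ {u} → u ∈ₗ xs → u ∈ S) → 2 ≤ length (filter (adjacent? G y) xs) → NeighbourPair G S y
pairFromList {G = G} {y = y} {xs} unique xs⊆S two
  with length≥2⇒distinct (Unique.filter⁺ (adjacent? G y) unique) two
... | a , b , a≢b , a∈ , b∈
  with ∈-filter⁻ (adjacent? G y) {xs = xs} a∈ | ∈-filter⁻ (adjacent? G y) {xs = xs} b∈
...   | a∈xs , y~a | b∈xs , y~b = neighbourPair a b a≢b (xs⊆S a∈xs) (xs⊆S b∈xs) y~a y~b

degree⇒pair : ∀ {n} {G : Graph n} {y} → 2 ≤ degree G y → NeighbourPair G ⊤ y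
degree⇒pair {n} {G} {y} = pairFromList {G = G} {y = y} (Unique.allFin⁺ n) (λ _ → ∈⊤)

nbrsIn⇒pair : ∀ {n} {G : Graph n} {S y} → 2 ≤ nbrsIn G S y → NeighbourPair G S y
nbrsIn⇒pair {n} {G} {S} {y} =
  pairFromList {G = G} {y = y} (Unique.filter⁺ (_∈? S) (Unique.allFin⁺ n))
               (λ u∈ → proj₂ (∈-filter⁻ (_∈? S) {xs = allFin n} u∈))

pair⇒nbrsIn : ∀ {n} {G : Graph n} {S y} → NeighbourPair G S y → 2 ≤ nbrsIn G S y
pair⇒nbrsIn {n} {G} {S} {y} (neighbourPair a b a≢b a∈S b∈S y~a y~b) =
  distinct⇒length≥2 a≢b (counted a∈S y~a) (counted b∈S y~b)
  where
  counted : ∀ {u} → u ∈ S → Adjacent G y u →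
    u ∈ₗ filter (adjacent? G y) (filter (_∈? S) (allFin n))
  counted {u} u∈S y~u = ∈-filter⁺ (adjacent? G y) (∈-filter⁺ (_∈? S) (∈-allFin u) u∈S) y~u

∣p∪q∣≤∣p∣+∣q∣ : ∀ {n} (p q : Subset n) → ∣ p ∪ q ∣ ≤ ∣ p ∣ + ∣ q ∣
∣p∪q∣≤∣p∣+∣q∣ [] [] = z≤n
∣p∪q∣≤∣p∣+∣q∣ (inside ∷ p) (inside ∷ q) =
  s≤s (≤-trans (m≤n⇒m≤1+n (∣p∪q∣≤∣p∣+∣q∣ p q)) (≤-reflexive (≡.sym (+-suc ∣ p ∣ ∣ q ∣))))
∣p∪q∣≤∣p∣+∣q∣ (inside ∷ p) (outside ∷ q) = s≤s (∣p∪q∣≤∣p∣+∣q∣ p q)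
∣p∪q∣≤∣p∣+∣q∣ (outside ∷ p) (inside ∷ q) =
  ≤-trans (s≤s (∣p∪q∣≤∣p∣+∣q∣ p q)) (≤-reflexive (≡.sym (+-suc ∣ p ∣ ∣ q ∣)))
∣p∪q∣≤∣p∣+∣q∣ (outside ∷ p) (outside ∷ q) = ∣p∪q∣≤∣p∣+∣q∣ p q

fromList : ∀ {n} → List (Fin n) → Subset n
fromList []       = ⊥
fromList (x ∷ xs) = ⁅ x ⁆ ∪ fromList xs

∈-fromList : ∀ {n} {x : Fin n} xs → x ∈ₗ xs → x ∈ fromList xs
∈-fromList (x ∷ _)  (here refl)  = x∈p∪q⁺ (inj₁ (x∈⁅x⁆ x))
∈-fromList (_ ∷ xs) (there x∈xs) = x∈p∪q⁺ (inj₂ (∈-fromList xs x∈xs))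

∣fromList∣≤length : ∀ {n} (xs : List (Fin n)) → ∣ fromList xs ∣ ≤ length xs
∣fromList∣≤length {n} []       = ≤-reflexive (∣⊥∣≡0 n)
∣fromList∣≤length (x ∷ xs) =
  ≤-trans (∣p∪q∣≤∣p∣+∣q∣ ⁅ x ⁆ (fromList xs))
          (+-mono-≤ (≤-reflexive (∣⁅x⁆∣≡1 x)) (∣fromList∣≤length xs))

unionOver : ∀ {m n} → Subset m → (Fin m → Subset n) → Subset n
unionOver []            f = ⊥
unionOver (inside ∷ R)  f = f zero ∪ unionOver R (f ∘ suc)
unionOver (outside ∷ R) f = unionOver R (f ∘ suc)

⊆-unionOver : ∀ {m n} {R : Subset m} (f : Fin m → Subset n) {y} → y ∈ R → f y ⊆ unionOver R f
⊆-unionOver {R = inside ∷ R}  f Vec.here         = p⊆p∪q (unionOver R (f ∘ suc))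
⊆-unionOver {R = inside ∷ R}  f (Vec.there y∈R) =
  λ x∈ → q⊆p∪q (f zero) (unionOver R (f ∘ suc)) (⊆-unionOver (f ∘ suc) y∈R x∈)
⊆-unionOver {R = outside ∷ R} f (Vec.there y∈R) = ⊆-unionOver (f ∘ suc) y∈R

∣unionOver∣≤ : ∀ {m n} (R : Subset m) (f : Fin m → Subset n) {k} →
  (∀ y → ∣ f y ∣ ≤ k) → ∣ unionOver R f ∣ ≤ k * ∣ R ∣
∣unionOver∣≤ {n = n} [] f _ = ≤-trans (≤-reflexive (∣⊥∣≡0 n)) z≤n
∣unionOver∣≤ (inside ∷ R) f {k} f≤k =
  ≤-trans (∣p∪q∣≤∣p∣+∣q∣ (f zero) (unionOver R (f ∘ suc)))
          (≤-trans (+-mono-≤ (f≤k zero) (∣unionOver∣≤ R (f ∘ suc) (f≤k ∘ suc)))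
                   (≤-reflexive (≡.sym (*-suc k ∣ R ∣))))
∣unionOver∣≤ (outside ∷ R) f f≤k = ∣unionOver∣≤ R (f ∘ suc) (f≤k ∘ suc)

removeAll : ∀ {n} → Subset n → List (Fin n) → Subset n
removeAll p []       = p
removeAll p (x ∷ xs) = removeAll (p - x) xs

∣removeAll∣ : ∀ {n} {p : Subset n} {xs} → Unique xs → All (_∈ p) xs →
  ∣ removeAll p xs ∣ + length xs ≤ ∣ p ∣
∣removeAll∣ {p = p} {[]} _ _ = ≤-reflexive (+-identityʳ ∣ p ∣)
∣removeAll∣ {p = p} {x ∷ xs} (x∉xs ∷ unique) (x∈p ∷ xs⊆p) = begin
  ∣ removeAll (p - x) xs ∣ + suc (length xs)   ≡⟨ +-suc _ (length xs) ⟩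
  suc (∣ removeAll (p - x) xs ∣ + length xs)   ≤⟨ s≤s (∣removeAll∣ unique xs⊆p-x) ⟩
  suc ∣ p - x ∣                                ≤⟨ x∈p⇒∣p-x∣<∣p∣ x∈p ⟩
  ∣ p ∣                                        ∎
  where
  open ≤-Reasoning
  xs⊆p-x : All (_∈ p - x) xs
  xs⊆p-x = All.zipWith (λ (y∈p , x≢y) → x∈p∧x≢y⇒x∈p-y y∈p (≢-sym x≢y)) (xs⊆p , x∉xs)

∉removeAll : ∀ {n} {p : Subset n} {y} xs → y ∈ p → y ∉ removeAll p xs → y ∈ₗ xs
∉removeAll [] y∈p y∉ = ⊥-elim (y∉ y∈p)
∉removeAll {y = y} (x ∷ xs) y∈p y∉ with y ≟ x
... | yes refl = here refl
... | no y≢x   = there (∉removeAll xs (x∈p∧x≢y⇒x∈p-y y∈p y≢x) y∉)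

-- The arithmetic of the saving lemma: |D'| ≤ |S| + 2|R| with |S| ≤ |D| + e,
-- |R| + r ≤ |D| and e + 2 ≤ 2r give |D'| + 2 ≤ 3|D|.
savingArithmetic : ∀ {d' s ρ d e r} → d' ≤ s + 2 * ρ → s ≤ d + e → ρ + r ≤ d →
  e + 2 ≤ 2 * r → d' + 2 ≤ 3 * d
savingArithmetic {d'} {s} {ρ} {d} {e} {r} d'≤ s≤ ρ+r≤ e+2≤ = begin
  d' + 2                ≤⟨ +-monoˡ-≤ 2 d'≤ ⟩
  s + 2 * ρ + 2         ≤⟨ +-monoˡ-≤ 2 (+-monoˡ-≤ (2 * ρ) s≤) ⟩
  d + e + 2 * ρ + 2     ≡⟨ regroup₁ d e ρ ⟩
  d + 2 * ρ + (e + 2)   ≤⟨ +-monoʳ-≤ (d + 2 * ρ) e+2≤ ⟩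
  d + 2 * ρ + 2 * r     ≡⟨ regroup₂ d ρ r ⟩
  d + 2 * (ρ + r)       ≤⟨ +-monoʳ-≤ d (*-monoʳ-≤ 2 ρ+r≤) ⟩
  d + 2 * d             ≡⟨ regroup₃ d ⟩
  3 * d                 ∎
  where
  open ≤-Reasoning
  regroup₁ : ∀ d e ρ → d + e + 2 * ρ + 2 ≡ d + 2 * ρ + (e + 2)
  regroup₁ = solve-∀
  regroup₂ : ∀ d ρ r → d + 2 * ρ + 2 * r ≡ d + 2 * (ρ + r)
  regroup₂ = solve-∀
  regroup₃ : ∀ d → d + 2 * d ≡ 3 * d
  regroup₃ = solve-∀

module MinimumDegreeTwo {n} (G : Graph n) (δ : MinDegreeAtLeast G 2) where

  neighbours : ∀ y → NeighbourPair G ⊤ y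
  neighbours y = degree⇒pair (δ y)

  anotherNeighbour : ∀ y c → ∃ λ o → Adjacent G y o × o ≢ c
  anotherNeighbour y c with avoiding (neighbours y) c
  ... | o , _ , y~o , o≢c = o , y~o , o≢c

  completion : ∀ (S R : Subset n) → (∀ y → y ∉ R → NeighbourPair G S y) →
    ∃ λ D' → IsDoubleTotalDominating G D' × ∣ D' ∣ ≤ ∣ S ∣ + 2 * ∣ R ∣
  completion S R covered = S ∪ unionOver R chosen , doubleTotal , size
    where
    chosenList : Fin n → List (Fin n)
    chosenList y = first (neighbours y) ∷ second (neighbours y) ∷ []

    chosen : Fin n → Subset n
    chosen y = fromList (chosenList y)

    doubleTotal : IsDoubleTotalDominating G (S ∪ unionOver R chosen)
    doubleTotal y with y ∈? R
    ... | no y∉R  = pair⇒nbrsIn (widen (p⊆p∪q (unionOver R chosen)) (covered y y∉R))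
    ... | yes y∈R = pair⇒nbrsIn (relocate (neighbours y) (added (here refl)) (added (there (here refl))))
      where
      added : ∀ {u} → u ∈ₗ chosenList y → u ∈ S ∪ unionOver R chosen
      added u∈ = q⊆p∪q S (unionOver R chosen) (⊆-unionOver chosen y∈R (∈-fromList (chosenList y) u∈))

    size : ∣ S ∪ unionOver R chosen ∣ ≤ ∣ S ∣ + 2 * ∣ R ∣
    size = ≤-trans (∣p∪q∣≤∣p∣+∣q∣ S (unionOver R chosen))
                   (+-monoʳ-≤ ∣ S ∣ (∣unionOver∣≤ R chosen (λ y → ∣fromList∣≤length (chosenList y))))

module Construction {n} (G : Graph n) (δ : MinDegreeAtLeast G 2)
                    (D : Subset n) (dom : IsTwoDominating G D) where

  open MinimumDegreeTwo G δ

  Improvement : Set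
  Improvement = ∃ λ D' → IsDoubleTotalDominating G D' × ∣ D' ∣ + 2 ≤ 3 * ∣ D ∣

  dominators : ∀ y → y ∉ D → NeighbourPair G D y
  dominators y y∉D = nbrsIn⇒pair {G = G} {S = D} (dom y y∉D)

  anotherDominator : ∀ y → y ∉ D → ∀ c → ∃ λ w → w ∈ D × Adjacent G y w × w ≢ c
  anotherDominator y y∉D = avoiding (dominators y y∉D)

  inD : ∀ extra {y} → y ∈ D → y ∈ D ∪ fromList extra
  inD extra y∈D = x∈p∪q⁺ (inj₁ y∈D)

  inExtra : ∀ extra {y} → y ∈ₗ extra → y ∈ D ∪ fromList extra
  inExtra extra y∈extra = x∈p∪q⁺ (inj₂ (∈-fromList extra y∈extra))

  saving : ∀ (extra removed : List (Fin n)) → Unique removed → All (_∈ D) removed →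
    (∀ {y} → y ∈ₗ removed → NeighbourPair G (D ∪ fromList extra) y) →
    length extra + 2 ≤ 2 * length removed → Improvement
  saving extra removed unique removed⊆D covered budget =
    let D' , doubleTotal , size = completion (D ∪ fromList extra) (removeAll D removed) coveredOutside
    in D' , doubleTotal , savingArithmetic {ρ = ∣ removeAll D removed ∣} {r = length removed} size enlarged (∣removeAll∣ unique removed⊆D) budget
    where
    coveredOutside : ∀ y → y ∉ removeAll D removed → NeighbourPair G (D ∪ fromList extra) y
    coveredOutside y y∉R with y ∈? D
    ... | yes y∈D = covered (∉removeAll removed y∈D y∉R)
    ... | no y∉D  = widen (p⊆p∪q (fromList extra)) (dominators y y∉D)

    enlarged : ∣ D ∪ fromList extra ∣ ≤ ∣ D ∣ + length extra
    enlarged = ≤-trans (∣p∪q∣≤∣p∣+∣q∣ D (fromList extra)) (+-monoʳ-≤ ∣ D ∣ (∣fromList∣≤length extra))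

  -- Case 1: two adjacent vertices v, u of D see each other and one further
  -- neighbour each.
  adjacentInD : ∀ {v u} → v ∈ D → u ∈ D → Adjacent G v u → Improvement
  adjacentInD {v} {u} v∈D u∈D v~u with anotherNeighbour v u | anotherNeighbour u v
  ... | oᵥ , v~oᵥ , oᵥ≢u | oᵤ , u~oᵤ , oᵤ≢v =
    saving extra (v ∷ u ∷ []) ((adjacent⇒≢ G v~u ∷ []) ∷ [] ∷ []) (v∈D ∷ u∈D ∷ []) covered ≤-refl
    where
    extra : List (Fin n)
    extra = oᵥ ∷ oᵤ ∷ []
    covered : ∀ {y} → y ∈ₗ v ∷ u ∷ [] → NeighbourPair G (D ∪ fromList extra) y
    covered (here refl) =
      neighbourPair u oᵥ (≢-sym oᵥ≢u) (inD extra u∈D) (inExtra extra (here refl)) v~u v~oᵥ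
    covered (there (here refl)) =
      neighbourPair v oᵤ (≢-sym oᵤ≢v) (inD extra v∈D) (inExtra extra (there (here refl))) (adjacent-sym G v~u) u~oᵤ

  -- Case 2: v ∈ D has distinct neighbours a, b ∉ D; they are dominated by
  -- w, x ∈ D other than v.  Putting a, b into the set serves v, and serves w
  -- and x up to one further neighbour each (none if w = x).
  outsideNeighbours : ∀ {v a b} → v ∈ D → a ∉ D → b ∉ D → a ≢ b →
    Adjacent G v a → Adjacent G v b → Improvement
  outsideNeighbours {v} {a} {b} v∈D a∉D b∉D a≢b v~a v~b
    with anotherDominator a a∉D v | anotherDominator b b∉D v
  ... | w , w∈D , a~w , w≢v | x , x∈D , b~x , x≢v with w ≟ x
  ...   | yes refl =
    saving extra (v ∷ w ∷ []) ((≢-sym w≢v ∷ []) ∷ [] ∷ []) (v∈D ∷ w∈D ∷ []) covered ≤-refl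
    where
    extra : List (Fin n)
    extra = a ∷ b ∷ []
    covered : ∀ {y} → y ∈ₗ v ∷ w ∷ [] → NeighbourPair G (D ∪ fromList extra) y
    covered (here refl) =
      neighbourPair a b a≢b (inExtra extra (here refl)) (inExtra extra (there (here refl))) v~a v~b
    covered (there (here refl)) =
      neighbourPair a b a≢b (inExtra extra (here refl)) (inExtra extra (there (here refl)))
                    (adjacent-sym G a~w) (adjacent-sym G b~x)
  ...   | no w≢x with anotherNeighbour w a | anotherNeighbour x b
  ...     | oʷ , w~oʷ , oʷ≢a | oˣ , x~oˣ , oˣ≢b =
    saving extra (v ∷ w ∷ x ∷ []) ((≢-sym w≢v ∷ ≢-sym x≢v ∷ []) ∷ (w≢x ∷ []) ∷ [] ∷ [])
           (v∈D ∷ w∈D ∷ x∈D ∷ []) covered ≤-refl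
    where
    extra : List (Fin n)
    extra = a ∷ b ∷ oʷ ∷ oˣ ∷ []
    covered : ∀ {y} → y ∈ₗ v ∷ w ∷ x ∷ [] → NeighbourPair G (D ∪ fromList extra) y
    covered (here refl) =
      neighbourPair a b a≢b (inExtra extra (here refl)) (inExtra extra (there (here refl))) v~a v~b
    covered (there (here refl)) =
      neighbourPair a oʷ (≢-sym oʷ≢a) (inExtra extra (here refl)) (inExtra extra (there (there (here refl))))
                    (adjacent-sym G a~w) w~oʷ
    covered (there (there (here refl))) =
      neighbourPair b oˣ (≢-sym oˣ≢b) (inExtra extra (there (here refl)))
                    (inExtra extra (there (there (there (here refl))))) (adjacent-sym G b~x) x~oˣ

  someMember : Fin n → ∃ (_∈ D)
  someMember z with z ∈? D
  ... | yes z∈D = z , z∈D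
  ... | no z∉D  = first (dominators z z∉D) , first∈S (dominators z z∉D)

  improve : Fin n → Improvement
  improve z with someMember z
  ... | v , v∈D with neighbours v
  ...   | neighbourPair a b a≢b _ _ v~a v~b with a ∈? D | b ∈? D
  ...     | yes a∈D | _       = adjacentInD v∈D a∈D v~a
  ...     | no _    | yes b∈D = adjacentInD v∈D b∈D v~b
  ...     | no a∉D  | no b∉D  = outsideNeighbours v∈D a∉D b∉D a≢b v~a v~b

mainTheorem16 : ∀ {n} (G : Graph n) → 1 ≤ n → MinDegreeAtLeast G 2 →
    ∀ g2 gt → IsGamma2 G g2 → IsGammaTimes2 G gt → gt + 2 ≤ 3 * g2
mainTheorem16 {suc _} G _ δ g2 gt ((D , dom , refl) , _) (_ , minimal)
  with Construction.improve G δ D dom zero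
... | D' , doubleTotal , bound = ≤-trans (+-monoˡ-≤ 2 (minimal D' doubleTotal)) bound
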